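{- Given two ordinals $\alpha,\beta<\varepsilon_0$ in Cantor normal form notation, one can decide which of $\alpha<\beta$, $\alpha=\beta$, $\alpha>\beta$ holds within time $\mathcal{O}(\mathbf{c}(\alpha)+\mathbf{c}(\beta))$.
   Context: $\varepsilon_0$ is the least ordinal $\alpha$ with $\omega^\alpha=\alpha$. Every $\alpha<\varepsilon_0$ is uniquely written in Cantor normal form $\alpha=\omega^{\beta_0}+\cdots+\omega^{\beta_{k-1}}$ with $\beta_0\ge\cdots\ge\beta_{k-1}$, $k\ge0$, and is encoded by recursively encoding the exponents in the same way. The size is $\mathbf{c}(\alpha)=1+\mathbf{c}(\beta_0)+\cdots+\mathbf{c}(\beta_{k-1})$. Time is measured in the random access machine model with unit cost per instruction. -}

module Defs where

open import Data.Nat using (ℕ; zero; suc; _+_; _*_; _∸_; _≡ᵇ_; _≤_)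
open import Data.Bool using (Bool; true; false; if_then_else_)
open import Data.List using (List; []; _∷_; length; _++_)
open import Data.List.Relation.Unary.All using (All)
open import Data.Maybe using (Maybe; just; nothing)
open import Data.Sum using (_⊎_)
open import Data.Product using (_×_; Σ-syntax)
open import Relation.Binary.PropositionalEquality using (_≡_)

-- Cantor normal form notations below ε₀
-- cnf [β₀ , … , β_{k-1}]  denotes  ω^β₀ + ⋯ + ω^β_{k-1}

data Cnf : Set where
  cnf : List Cnf → Cnf

mutual
  data _<ₒ_ : Cnf → Cnf → Set where
    lt : ∀ {xs ys} → xs <ₗ ys → cnf xs <ₒ cnf ys

  data _<ₗ_ : List Cnf → List Cnf → Set where
    []<∷  : ∀ {y ys} → [] <ₗ (y ∷ ys)
    head< : ∀ {x y xs ys} → x <ₒ y → (x ∷ xs) <ₗ (y ∷ ys)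
    tail< : ∀ {x xs ys} → xs <ₗ ys → (x ∷ xs) <ₗ (x ∷ ys)

data Desc : List Cnf → Set where
  []  : Desc []
  [_] : ∀ x → Desc (x ∷ [])
  _∷_ : ∀ {x y ys} → (y <ₒ x ⊎ y ≡ x) → Desc (y ∷ ys) → Desc (x ∷ y ∷ ys)

data NF : Cnf → Set where
  nf : ∀ {xs} → All NF xs → Desc xs → NF (cnf xs)

mutual
  size : Cnf → ℕ
  size (cnf xs) = suc (sizes xs)

  sizes : List Cnf → ℕ
  sizes []       = 0
  sizes (x ∷ xs) = size x + sizes xs

-- Encoding in memory (preorder, one cell per node, each node stores its
-- number of summands k):  enc α has length c(α).
mutual
  enc : Cnf → List ℕ
  enc (cnf xs) = length xs ∷ encs xs

  encs : List Cnf → List ℕ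
  encs []       = []
  encs (x ∷ xs) = enc x ++ encs xs

-- Random access machine with unit cost per instruction.
-- Registers R : ℕ → ℕ (directly addressed) and memory M : ℕ → ℕ
-- (indirectly addressed through registers).

data Instr : Set where
  lit   : ℕ → ℕ → Instr        -- R i := n
  add   : ℕ → ℕ → ℕ → Instr    -- R i := R j + R k
  sub   : ℕ → ℕ → ℕ → Instr    -- R i := R j ∸ R k
  load  : ℕ → ℕ → Instr        -- R i := M (R j)
  store : ℕ → ℕ → Instr        -- M (R i) := R j
  jz    : ℕ → ℕ → Instr        -- if R i = 0 then goto l
  jmp   : ℕ → Instr            -- goto l
  halt  : Instr

Program : Set
Program = List Instr

record Config : Set where
  constructor ⟨_,_,_⟩
  field
    pc  : ℕ
    reg : ℕ → ℕ
    mem : ℕ → ℕ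
open Config public

update : (ℕ → ℕ) → ℕ → ℕ → (ℕ → ℕ)
update f i v j = if j ≡ᵇ i then v else f j

fetch : Program → ℕ → Maybe Instr
fetch []       _       = nothing
fetch (x ∷ _)  zero    = just x
fetch (_ ∷ p)  (suc n) = fetch p n

-- one step; nothing = the machine has halted (halt instruction or pc
-- outside the program)
step : Program → Config → Maybe Config
step p ⟨ c , R , M ⟩ with fetch p c
... | nothing          = nothing
... | just halt        = nothing
... | just (lit i n)   = just ⟨ suc c , update R i n , M ⟩
... | just (add i j k) = just ⟨ suc c , update R i (R j + R k) , M ⟩
... | just (sub i j k) = just ⟨ suc c , update R i (R j ∸ R k) , M ⟩
... | just (load i j)  = just ⟨ suc c , update R i (M (R j)) , M ⟩
... | just (store i j) = just ⟨ suc c , R , update M (R i) (R j) ⟩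
... | just (jz i l)    = just ⟨ (if R i ≡ᵇ 0 then l else suc c) , R , M ⟩
... | just (jmp l)     = just ⟨ l , R , M ⟩

-- run for at most t steps; just s = halted in configuration s
run : Program → ℕ → Config → Maybe Config
run p t s with step p s
... | nothing = just s
run p zero    s | just _  = nothing
run p (suc t) s | just s' = run p t s'

listMem : List ℕ → ℕ → ℕ
listMem []       _       = 0
listMem (x ∷ _)  zero    = x
listMem (_ ∷ l)  (suc n) = listMem l n

initial : Cnf → Cnf → Config
initial α β = ⟨ 0 , update (update (λ _ → 0) 0 (size α)) 1 (size β) , listMem (enc α ++ enc β) ⟩

Answers : Cnf → Cnf → ℕ → Set
Answers α β r = (r ≡ 0 × α <ₒ β) ⊎ (r ≡ 1 × α ≡ β) ⊎ (r ≡ 2 × β <ₒ α)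

DecidesWithin : Program → Cnf → Cnf → ℕ → Set
DecidesWithin P α β t = Σ[ s ∈ Config ] (run P t (initial α β) ≡ just s × Answers α β (reg s 0))

-- The program compares the two encodings lexicographically in one simultaneous
-- preorder traversal: at each level it holds the number of summands still to be
-- compared on either side, descends into the next pair of exponents, and keeps the
-- counts of the interrupted levels on a stack in memory.  A level is left only when
-- both sides run out of summands together; when just one side does, that side is the
-- smaller and the program halts.  Every node of α is entered and left at most once,
-- each at constant cost, so the running time is O(c(α)).
module Submission where

open import Defs
open import Data.Nat using (ℕ; _+_; _*_)
open import Data.Product using (Σ-syntax)

open import Data.Nat using (zero; suc; _∸_; _≤_; _<_; _≡ᵇ_; s≤s; s≤s⁻¹; z<s)
open import Data.Nat.Properties
open import Data.Nat.Tactic.RingSolver using (solve-∀)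
open import Data.Bool using (T; true; false)
open import Data.List using (List; []; _∷_; length; _++_)
open import Data.List.Properties using (length-++; ++-assoc; ++-identityʳ)
open import Data.Maybe using (just; nothing)
open import Data.Sum using (_⊎_; inj₁; inj₂)
open import Data.Product using (_×_; _,_; proj₂; ∃-syntax)
open import Relation.Nullary using (contradiction)
open import Relation.Binary.PropositionalEquality
open ≡-Reasoning

_[_≔_] : (ℕ → ℕ) → ℕ → ℕ → ℕ → ℕ
f [ i ≔ v ] = update f i v

infixl 9 _[_≔_]

≡ᵇ-refl : ∀ n → (n ≡ᵇ n) ≡ true
≡ᵇ-refl zero    = refl
≡ᵇ-refl (suc n) = ≡ᵇ-refl n

update-hit : ∀ (f : ℕ → ℕ) {i v j} → j ≡ i → update f i v j ≡ v
update-hit f {i} refl rewrite ≡ᵇ-refl i = refl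

update-miss : ∀ (f : ℕ → ℕ) {i v j} → j ≢ i → update f i v j ≡ f j
update-miss f {i} {v} {j} j≢i with j ≡ᵇ i in eq
... | true  = contradiction (≡ᵇ⇒≡ j i (subst T (sym eq) _)) j≢i
... | false = refl

run-mono : ∀ {p t t' s s'} → t ≤ t' → run p t s ≡ just s' → run p t' s ≡ just s'
run-mono {p} {s = s} _ h with step p s
run-mono                              _        h  | nothing = h
run-mono {t = zero}                   _        () | just _
run-mono {p} {t = suc _} {t' = suc _} (s≤s le) h  | just s' = run-mono {p} {s = s'} le h

mutual
  encOnto : Cnf → List ℕ → List ℕ
  encOnto (cnf xs) rest = length xs ∷ encsOnto xs rest

  encsOnto : List Cnf → List ℕ → List ℕ
  encsOnto []       rest = rest
  encsOnto (x ∷ xs) rest = encOnto x (encsOnto xs rest)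

mutual
  encOnto-++ : ∀ α rest → encOnto α rest ≡ enc α ++ rest
  encOnto-++ (cnf xs) rest = cong (length xs ∷_) (encsOnto-++ xs rest)

  encsOnto-++ : ∀ xs rest → encsOnto xs rest ≡ encs xs ++ rest
  encsOnto-++ []       rest = refl
  encsOnto-++ (x ∷ xs) rest = begin
    encOnto x (encsOnto xs rest)  ≡⟨ cong (encOnto x) (encsOnto-++ xs rest) ⟩
    encOnto x (encs xs ++ rest)   ≡⟨ encOnto-++ x _ ⟩
    enc x ++ (encs xs ++ rest)    ≡⟨ ++-assoc (enc x) (encs xs) rest ⟨
    (enc x ++ encs xs) ++ rest    ∎

mutual
  length-enc : ∀ α → length (enc α) ≡ size α
  length-enc (cnf xs) = cong suc (length-encs xs)

  length-encs : ∀ xs → length (encs xs) ≡ sizes xs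
  length-encs []       = refl
  length-encs (x ∷ xs) = trans (length-++ (enc x)) (cong₂ _+_ (length-enc x) (length-encs xs))

listMem-after : ∀ (p : List ℕ) v q → listMem (p ++ v ∷ q) (length p) ≡ v
listMem-after []      v q = refl
listMem-after (_ ∷ p) v q = listMem-after p v q

length-prefix< : ∀ (p : List ℕ) v q → length p < length (p ++ v ∷ q)
length-prefix< p v q = subst (length p <_) (sym (length-++ p)) (m<m+n (length p) z<s)

-- A frame holds the summand lists still to be compared at one level of the traversal.

Frame : Set
Frame = List Cnf × List Cnf

StackAnswer : List Frame → ℕ → Set
StackAnswer []               r = r ≡ 1
StackAnswer ((xs , ys) ∷ fs) r =
  (r ≡ 0 × xs <ₗ ys) ⊎ (xs ≡ ys × StackAnswer fs r) ⊎ (r ≡ 2 × ys <ₗ xs)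

answer-descend : ∀ {as bs xs ys fs r} → StackAnswer ((as , bs) ∷ (xs , ys) ∷ fs) r
               → StackAnswer ((cnf as ∷ xs , cnf bs ∷ ys) ∷ fs) r
answer-descend (inj₁ (e , l))                                 = inj₁ (e , head< (lt l))
answer-descend (inj₂ (inj₁ (refl , inj₁ (e , l))))           = inj₁ (e , tail< l)
answer-descend (inj₂ (inj₁ (refl , inj₂ (inj₁ (refl , a))))) = inj₂ (inj₁ (refl , a))
answer-descend (inj₂ (inj₁ (refl , inj₂ (inj₂ (e , l)))))    = inj₂ (inj₂ (e , tail< l))
answer-descend (inj₂ (inj₂ (e , l)))                          = inj₂ (inj₂ (e , head< (lt l)))

answers-singleton : ∀ {α β r} → StackAnswer ((α ∷ [] , β ∷ []) ∷ []) r → Answers α β r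
answers-singleton (inj₁ (e , head< l))     = inj₁ (e , l)
answers-singleton (inj₂ (inj₁ (refl , e))) = inj₂ (inj₁ (e , refl))
answers-singleton (inj₂ (inj₂ (e , head< l))) = inj₂ (inj₂ (e , l))

-- Each summand still to be read on the left is entered once and its frame popped
-- once; each frame already on the stack is popped once.
loopBound : List Frame → ℕ
loopBound []              = 0
loopBound ((xs , _) ∷ fs) = suc (sizes xs + sizes xs + loopBound fs)

loopBound-descend : ∀ as bs xs ys fs
  → suc (loopBound ((as , bs) ∷ (xs , ys) ∷ fs)) ≡ loopBound ((cnf as ∷ xs , cnf bs ∷ ys) ∷ fs)
loopBound-descend as _ xs _ fs = arith (sizes as) (sizes xs) (loopBound fs)
  where
  arith : ∀ a b p → suc (suc (a + a + suc (b + b + p))) ≡ suc (suc (a + b) + suc (a + b) + p)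
  arith = solve-∀

-- Registers 0 and 1 hold the input sizes (and register 0 finally the answer);
-- ptrA and ptrB point to the next unread cell of each encoding, remA and remB
-- count the summands left at the current level, and the stack of the counts of the
-- interrupted levels grows upwards from address base = c(α) + c(β), two cells per
-- frame, with top the first free cell.

ptrA ptrB top remA remB tmp one two base : ℕ
ptrA = 2
ptrB = 3
top  = 4
remA = 5
remB = 6
tmp  = 7
one  = 8
two  = 9
base = 10

compare : Program
compare =
    lit one 1 ∷ lit two 2 ∷ add ptrB 0 ptrA ∷ add base 0 1 ∷ add top 0 1 ∷ lit remA 1 ∷ lit remB 1
  -- 7
  ∷ jz remA 20 ∷ jz remB 31
  ∷ sub remA remA one ∷ sub remB remB one ∷ store top remA ∷ add tmp top one ∷ store tmp remB
  ∷ add top top two ∷ load remA ptrA ∷ load remB ptrB ∷ add ptrA ptrA one ∷ add ptrB ptrB one ∷ jmp 7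
  -- 20
  ∷ jz remB 22 ∷ jmp 29
  -- 22
  ∷ sub tmp top base ∷ jz tmp 33 ∷ sub top top two ∷ load remA top ∷ add tmp top one ∷ load remB tmp
  ∷ jmp 7
  -- 29
  ∷ lit 0 0 ∷ halt ∷ lit 0 2 ∷ halt ∷ lit 0 1 ∷ halt ∷ []

jz-taken : ∀ {i l t} c R M → fetch compare c ≡ just (jz i l) → R i ≡ 0
         → run compare (suc t) ⟨ c , R , M ⟩ ≡ run compare t ⟨ l , R , M ⟩
jz-taken _ _ _ f z rewrite f | z = refl

jz-skip : ∀ {i l k t} c R M → fetch compare c ≡ just (jz i l) → R i ≡ suc k
        → run compare (suc t) ⟨ c , R , M ⟩ ≡ run compare t ⟨ suc c , R , M ⟩
jz-skip _ _ _ f z rewrite f | z = refl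

descendMem : (ℕ → ℕ) → (ℕ → ℕ) → ℕ → ℕ
descendMem R M = M [ R top ≔ R remA ∸ R one ] [ R top + R one ≔ R remB ∸ R one ]

descendRegs : (ℕ → ℕ) → (ℕ → ℕ) → ℕ → ℕ
descendRegs R M =
  R [ remA ≔ R remA ∸ R one ] [ remB ≔ R remB ∸ R one ] [ tmp ≔ R top + R one ]
    [ top ≔ R top + R two ] [ remA ≔ descendMem R M (R ptrA) ] [ remB ≔ descendMem R M (R ptrB) ]
    [ ptrA ≔ R ptrA + R one ] [ ptrB ≔ R ptrB + R one ]

popRegs : (ℕ → ℕ) → (ℕ → ℕ) → ℕ → ℕ
popRegs R M =
  R [ tmp ≔ R top ∸ R base ] [ top ≔ R top ∸ R two ] [ remA ≔ M (R top ∸ R two) ]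
    [ tmp ≔ R top ∸ R two + R one ] [ remB ≔ M (R top ∸ R two + R one) ]

descendMem-below : ∀ R M {a} → a < R top → descendMem R M a ≡ M a
descendMem-below R M a<top =
  trans (update-miss (M [ R top ≔ R remA ∸ R one ]) {R top + R one} {R remB ∸ R one}
                     (<⇒≢ (<-≤-trans a<top (m≤m+n (R top) (R one)))))
        (update-miss M {R top} {R remA ∸ R one} (<⇒≢ a<top))

record Resolves (fs : List Frame) (s : Config) (t : ℕ) : Set where
  constructor resolves
  field
    final  : Config
    halts  : run compare t s ≡ just final
    answer : StackAnswer fs (reg final 0)

resolves-mono : ∀ {fs s t t'} → t ≤ t' → Resolves fs s t → Resolves fs s t'
resolves-mono {s = s} le (resolves s' e a) = resolves s' (run-mono {compare} {s = s} le e) a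

resolves-via : ∀ {fs fs' s s' t t'} → (∀ {r} → StackAnswer fs' r → StackAnswer fs r)
             → run compare t s ≡ run compare t' s' → Resolves fs' s' t' → Resolves fs s t
resolves-via f e (resolves s'' e' a) = resolves s'' (trans e e') (f a)

time-bound : ∀ α β → 7 + (loopBound ((α ∷ [] , β ∷ []) ∷ []) * 13 + 5) ≤ 26 * (size α + size β)
time-bound α β@(cnf bs) =
  m+n≤o⇒m≤o (7 + (loopBound ((α ∷ [] , β ∷ []) ∷ []) * 13 + 5)) (≤-reflexive (arith (size α) (sizes bs)))
  where
  arith : ∀ a b → 7 + (suc (a + 0 + (a + 0) + 0) * 13 + 5) + (1 + 26 * b) ≡ 26 * (a + suc b)
  arith = solve-∀

module Comparison (α β : Cnf) where

  input : List ℕ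
  input = enc α ++ enc β

  stackBase : ℕ
  stackBase = size α + size β

  length-input : length input ≡ stackBase
  length-input = trans (length-++ (enc α)) (cong₂ _+_ (length-enc α) (length-enc β))

  prefix<stackBase : ∀ {p v q} → input ≡ p ++ v ∷ q → length p < stackBase
  prefix<stackBase {p} {v} {q} e =
    subst (length p <_) (trans (cong length (sym e)) length-input) (length-prefix< p v q)

  data Stack (M : ℕ → ℕ) : ℕ → List Frame → Set where
    empty : Stack M stackBase []
    push  : ∀ {sp xs ys fs} → M sp ≡ length xs → M (suc sp) ≡ length ys
          → Stack M sp fs → Stack M (2 + sp) ((xs , ys) ∷ fs)

  stackBase≤ : ∀ {M sp fs} → Stack M sp fs → stackBase ≤ sp
  stackBase≤ empty        = ≤-refl
  stackBase≤ (push _ _ s) = m≤n⇒m≤1+n (m≤n⇒m≤1+n (stackBase≤ s))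

  stack-empty : ∀ {M sp} → Stack M sp [] → sp ≡ stackBase
  stack-empty empty = refl

  stack-nonempty : ∀ {M sp f fs} → Stack M sp (f ∷ fs) → ∃[ k ] sp ∸ stackBase ≡ suc k
  stack-nonempty (push _ _ s) = _ , +-∸-assoc 2 (stackBase≤ s)

  stack-cong : ∀ {M M' sp fs} → (∀ {a} → a < sp → M' a ≡ M a) → Stack M sp fs → Stack M' sp fs
  stack-cong _  empty            = empty
  stack-cong eq (push {sp'} x y s) =
    push (trans (eq (m<n⇒m<1+n (n<1+n sp'))) x) (trans (eq (n<1+n (suc sp'))) y)
         (stack-cong (λ a<sp' → eq (m<n⇒m<1+n (m<n⇒m<1+n a<sp'))) s)

  unreadA : List Frame → List ℕ
  unreadA []              = enc β
  unreadA ((xs , _) ∷ fs) = encsOnto xs (unreadA fs)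

  unreadB : List Frame → List ℕ
  unreadB []              = []
  unreadB ((_ , ys) ∷ fs) = encsOnto ys (unreadB fs)

  record Inv (xs ys : List Cnf) (fs : List Frame) (R M : ℕ → ℕ) : Set where
    field
      remA-length  : R remA ≡ length xs
      remB-length  : R remB ≡ length ys
      one-value    : R one ≡ 1
      two-value    : R two ≡ 2
      base-value   : R base ≡ stackBase
      readA        : List ℕ
      input-A      : input ≡ readA ++ encsOnto xs (unreadA fs)
      ptrA-value   : R ptrA ≡ length readA
      readB        : List ℕ
      input-B      : input ≡ readB ++ encsOnto ys (unreadB fs)
      ptrB-value   : R ptrB ≡ length readB
      sp           : ℕ
      top-value    : R top ≡ sp
      stack        : Stack M sp fs
      input-intact : ∀ {a} → a < stackBase → M a ≡ listMem input a

  open Inv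

  setupRegs : ℕ → ℕ
  setupRegs = reg (initial α β) [ one ≔ 1 ] [ two ≔ 2 ] [ ptrB ≔ size α + 0 ]
    [ base ≔ stackBase ] [ top ≔ stackBase ] [ remA ≔ 1 ] [ remB ≔ 1 ]

  setup : ∀ {fs t} → Resolves fs ⟨ 7 , setupRegs , listMem input ⟩ t → Resolves fs (initial α β) (7 + t)
  setup = resolves-via (λ a → a) refl

  setup-inv : Inv (α ∷ []) (β ∷ []) [] setupRegs (listMem input)
  setup-inv = record
    { remA-length  = refl
    ; remB-length  = refl
    ; one-value    = refl
    ; two-value    = refl
    ; base-value   = refl
    ; readA        = []
    ; input-A      = sym (encOnto-++ α (enc β))
    ; ptrA-value   = refl
    ; readB        = enc α
    ; input-B      = cong (enc α ++_) (sym (trans (encOnto-++ β []) (++-identityʳ (enc β))))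
    ; ptrB-value   = trans (+-identityʳ (size α)) (sym (length-enc α))
    ; sp           = stackBase
    ; top-value    = refl
    ; stack        = empty
    ; input-intact = λ _ → refl
    }

  module _ {R M : ℕ → ℕ} {t : ℕ} where

    halt-equal : Inv [] [] [] R M → Resolves (([] , []) ∷ []) ⟨ 7 , R , M ⟩ (5 + t)
    halt-equal I = resolves _ run-equal (inj₂ (inj₁ (refl , refl)))
      where
      at-base : R top ∸ R base ≡ 0
      at-base = trans (cong₂ _∸_ (trans (top-value I) (stack-empty (stack I))) (base-value I))
                      (n∸n≡0 stackBase)
      run-equal : run compare (5 + t) ⟨ 7 , R , M ⟩ ≡ just ⟨ 34 , R [ tmp ≔ R top ∸ R base ] [ 0 ≔ 1 ] , M ⟩
      run-equal = begin
        run compare (5 + t) ⟨ 7 , R , M ⟩                                ≡⟨ jz-taken 7 R M refl (remA-length I) ⟩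
        run compare (4 + t) ⟨ 20 , R , M ⟩                               ≡⟨ jz-taken 20 R M refl (remB-length I) ⟩
        run compare (3 + t) ⟨ 22 , R , M ⟩                               ≡⟨⟩
        run compare (2 + t) ⟨ 23 , R [ tmp ≔ R top ∸ R base ] , M ⟩       ≡⟨ jz-taken 23 (R [ tmp ≔ R top ∸ R base ]) M refl at-base ⟩
        run compare (1 + t) ⟨ 33 , R [ tmp ≔ R top ∸ R base ] , M ⟩       ≡⟨⟩
        just ⟨ 34 , R [ tmp ≔ R top ∸ R base ] [ 0 ≔ 1 ] , M ⟩            ∎

    halt-less : ∀ {y ys fs} → Inv [] (y ∷ ys) fs R M → Resolves (([] , y ∷ ys) ∷ fs) ⟨ 7 , R , M ⟩ (4 + t)
    halt-less I = resolves _ run-less (inj₁ (refl , []<∷))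
      where
      run-less : run compare (4 + t) ⟨ 7 , R , M ⟩ ≡ just ⟨ 30 , R [ 0 ≔ 0 ] , M ⟩
      run-less = begin
        run compare (4 + t) ⟨ 7 , R , M ⟩   ≡⟨ jz-taken 7 R M refl (remA-length I) ⟩
        run compare (3 + t) ⟨ 20 , R , M ⟩  ≡⟨ jz-skip 20 R M refl (remB-length I) ⟩
        run compare (2 + t) ⟨ 21 , R , M ⟩  ≡⟨⟩
        just ⟨ 30 , R [ 0 ≔ 0 ] , M ⟩        ∎

    halt-greater : ∀ {x xs fs} → Inv (x ∷ xs) [] fs R M → Resolves ((x ∷ xs , []) ∷ fs) ⟨ 7 , R , M ⟩ (3 + t)
    halt-greater I = resolves _ run-greater (inj₂ (inj₂ (refl , []<∷)))
      where
      run-greater : run compare (3 + t) ⟨ 7 , R , M ⟩ ≡ just ⟨ 32 , R [ 0 ≔ 2 ] , M ⟩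
      run-greater = begin
        run compare (3 + t) ⟨ 7 , R , M ⟩   ≡⟨ jz-skip 7 R M refl (remA-length I) ⟩
        run compare (2 + t) ⟨ 8 , R , M ⟩   ≡⟨ jz-taken 8 R M refl (remB-length I) ⟩
        run compare (1 + t) ⟨ 31 , R , M ⟩  ≡⟨⟩
        just ⟨ 32 , R [ 0 ≔ 2 ] , M ⟩        ∎

    pop : ∀ {f fs} → Inv [] [] (f ∷ fs) R M → Resolves (f ∷ fs) ⟨ 7 , popRegs R M , M ⟩ t
        → Resolves (([] , []) ∷ f ∷ fs) ⟨ 7 , R , M ⟩ (9 + t)
    pop I = resolves-via (λ a → inj₂ (inj₁ (refl , a))) run-pop
      where
      above-base : R top ∸ R base ≡ suc _
      above-base = trans (cong₂ _∸_ (top-value I) (base-value I)) (proj₂ (stack-nonempty (stack I)))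
      run-pop : run compare (9 + t) ⟨ 7 , R , M ⟩ ≡ run compare t ⟨ 7 , popRegs R M , M ⟩
      run-pop = begin
        run compare (9 + t) ⟨ 7 , R , M ⟩                           ≡⟨ jz-taken 7 R M refl (remA-length I) ⟩
        run compare (8 + t) ⟨ 20 , R , M ⟩                          ≡⟨ jz-taken 20 R M refl (remB-length I) ⟩
        run compare (7 + t) ⟨ 22 , R , M ⟩                          ≡⟨⟩
        run compare (6 + t) ⟨ 23 , R [ tmp ≔ R top ∸ R base ] , M ⟩  ≡⟨ jz-skip 23 (R [ tmp ≔ R top ∸ R base ]) M refl above-base ⟩
        run compare (5 + t) ⟨ 24 , R [ tmp ≔ R top ∸ R base ] , M ⟩  ≡⟨⟩
        run compare t ⟨ 7 , popRegs R M , M ⟩                       ∎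

    descend : ∀ {as xs bs ys fs} → Inv (cnf as ∷ xs) (cnf bs ∷ ys) fs R M
            → Resolves ((as , bs) ∷ (xs , ys) ∷ fs) ⟨ 7 , descendRegs R M , descendMem R M ⟩ t
            → Resolves ((cnf as ∷ xs , cnf bs ∷ ys) ∷ fs) ⟨ 7 , R , M ⟩ (13 + t)
    descend I = resolves-via answer-descend run-descend
      where
      run-descend : run compare (13 + t) ⟨ 7 , R , M ⟩
                  ≡ run compare t ⟨ 7 , descendRegs R M , descendMem R M ⟩
      run-descend = begin
        run compare (13 + t) ⟨ 7 , R , M ⟩                      ≡⟨ jz-skip 7 R M refl (remA-length I) ⟩
        run compare (12 + t) ⟨ 8 , R , M ⟩                      ≡⟨ jz-skip 8 R M refl (remB-length I) ⟩
        run compare (11 + t) ⟨ 9 , R , M ⟩                      ≡⟨⟩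
        run compare t ⟨ 7 , descendRegs R M , descendMem R M ⟩  ∎

  pop-inv : ∀ {R M xs ys fs} → Inv [] [] ((xs , ys) ∷ fs) R M → Inv xs ys fs (popRegs R M) M
  pop-inv {R} {M} {xs} {ys} {fs} I = popped (stack I) (top-value I)
    where
    popped : ∀ {sp'} → Stack M sp' ((xs , ys) ∷ fs) → R top ≡ sp' → Inv xs ys fs (popRegs R M) M
    popped (push {sp} at-x at-y s) at-top = record
      { remA-length  = trans (cong M below-top) at-x
      ; remB-length  = trans (cong M (trans (cong₂ _+_ below-top (one-value I)) (+-comm sp 1))) at-y
      ; one-value    = one-value I
      ; two-value    = two-value I
      ; base-value   = base-value I
      ; readA        = readA I
      ; input-A      = input-A I
      ; ptrA-value   = ptrA-value I
      ; readB        = readB I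
      ; input-B      = input-B I
      ; ptrB-value   = ptrB-value I
      ; sp           = sp
      ; top-value    = below-top
      ; stack        = s
      ; input-intact = input-intact I
      }
      where
      below-top : R top ∸ R two ≡ sp
      below-top = cong₂ _∸_ at-top (two-value I)

  descend-inv : ∀ {R M as xs bs ys fs} → Inv (cnf as ∷ xs) (cnf bs ∷ ys) fs R M
              → Inv as bs ((xs , ys) ∷ fs) (descendRegs R M) (descendMem R M)
  descend-inv {R} {M} {as} {xs} {bs} {ys} I = record
    { remA-length  = read (ptrA-value I) (input-A I)
    ; remB-length  = read (ptrB-value I) (input-B I)
    ; one-value    = one-value I
    ; two-value    = two-value I
    ; base-value   = base-value I
    ; readA        = readA I ++ length as ∷ []
    ; input-A      = trans (input-A I) (sym (++-assoc (readA I) _ _))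
    ; ptrA-value   = trans (cong₂ _+_ (ptrA-value I) (one-value I)) (sym (length-++ (readA I)))
    ; readB        = readB I ++ length bs ∷ []
    ; input-B      = trans (input-B I) (sym (++-assoc (readB I) _ _))
    ; ptrB-value   = trans (cong₂ _+_ (ptrB-value I) (one-value I)) (sym (length-++ (readB I)))
    ; sp           = 2 + sp I
    ; top-value    = trans (cong₂ _+_ (top-value I) (two-value I)) (+-comm (sp I) 2)
    ; stack        = push pushed-xs pushed-ys (stack-cong below-sp (stack I))
    ; input-intact = λ a<base → trans (below-base a<base) (input-intact I a<base)
    }
    where
    below-sp : ∀ {a} → a < sp I → descendMem R M a ≡ M a
    below-sp a<sp = descendMem-below R M (subst (_ <_) (sym (top-value I)) a<sp)

    below-base : ∀ {a} → a < stackBase → descendMem R M a ≡ M a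
    below-base a<base = below-sp (<-≤-trans a<base (stackBase≤ (stack I)))

    read : ∀ {ptr p v q} → R ptr ≡ length p → input ≡ p ++ v ∷ q → descendMem R M (R ptr) ≡ v
    read {ptr} {p} {v} {q} at-ptr e = begin
      descendMem R M (R ptr)          ≡⟨ below-base (subst (_< stackBase) (sym at-ptr) (prefix<stackBase e)) ⟩
      M (R ptr)                       ≡⟨ cong M at-ptr ⟩
      M (length p)                    ≡⟨ input-intact I (prefix<stackBase e) ⟩
      listMem input (length p)        ≡⟨ cong (λ l → listMem l (length p)) e ⟩
      listMem (p ++ v ∷ q) (length p) ≡⟨ listMem-after p v q ⟩
      v                               ∎

    above-top : R top + R one ≡ suc (sp I)
    above-top = trans (cong₂ _+_ (top-value I) (one-value I)) (+-comm (sp I) 1)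

    pushed-xs : descendMem R M (sp I) ≡ length xs
    pushed-xs = begin
      descendMem R M (sp I)                 ≡⟨ update-miss (M [ R top ≔ R remA ∸ R one ])
                                                 (<⇒≢ (subst (sp I <_) (sym above-top) (n<1+n (sp I)))) ⟩
      (M [ R top ≔ R remA ∸ R one ]) (sp I) ≡⟨ update-hit M (sym (top-value I)) ⟩
      R remA ∸ R one                        ≡⟨ cong₂ _∸_ (remA-length I) (one-value I) ⟩
      length xs                             ∎

    pushed-ys : descendMem R M (suc (sp I)) ≡ length ys
    pushed-ys = trans (update-hit (M [ R top ≔ R remA ∸ R one ]) (sym above-top))
                      (cong₂ _∸_ (remB-length I) (one-value I))

  loop-resolves : ∀ n {xs ys fs R M} → loopBound ((xs , ys) ∷ fs) ≤ n → Inv xs ys fs R M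
                → Resolves ((xs , ys) ∷ fs) ⟨ 7 , R , M ⟩ (n * 13 + 5)
  loop-resolves (suc n) {[]}          {[]}          {[]}    _ I = halt-equal I
  loop-resolves (suc n) {[]}          {[]}          {_ ∷ _} b I =
    pop I (resolves-mono (m≤n+m (n * 13 + 5) 4) (loop-resolves n (s≤s⁻¹ b) (pop-inv I)))
  loop-resolves (suc n) {[]}          {_ ∷ _}               _ I = halt-less I
  loop-resolves (suc n) {_ ∷ _}       {[]}                  _ I = halt-greater I
  loop-resolves (suc n) {cnf as ∷ xs} {cnf bs ∷ ys} {fs}    b I =
    descend I (loop-resolves n (s≤s⁻¹ b′) (descend-inv I))
    where
    b′ : suc (loopBound ((as , bs) ∷ (xs , ys) ∷ fs)) ≤ suc n
    b′ = subst (_≤ suc n) (sym (loopBound-descend as bs xs ys fs)) b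

  decides : DecidesWithin compare α β (26 * (size α + size β))
  decides = final , halts , answers-singleton answer
    where
    open Resolves (resolves-mono (time-bound α β)
                    (setup (loop-resolves _ ≤-refl setup-inv)))

lemma5 : Σ[ P ∈ Program ] Σ[ C ∈ ℕ ]
    (∀ α β → NF α → NF β → DecidesWithin P α β (C * (size α + size β)))
lemma5 = compare , 26 , λ α β _ _ → Comparison.decides α β
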